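{- The variety $\mathbf{V}(\mathbf{L^{dm}_{10}})$ is defined, modulo $\mathbf{RDMSH_1}$, by the two identities (1) $x\wedge x'\le y\vee y'$ and (2) $x\to y\approx y\to x$; that is, it consists exactly of the members of $\mathbf{RDMSH_1}$ satisfying both identities.
   Context: A semi-Heyting algebra is an algebra $\langle L,\vee,\wedge,\to,0,1\rangle$ such that $\langle L,\vee,\wedge,0,1\rangle$ is a bounded lattice and the identities $x\wedge(x\to y)\approx x\wedge y$, $x\wedge(y\to z)\approx x\wedge((x\wedge y)\to(x\wedge z))$ and $x\to x\approx 1$ hold; write $x^*:=x\to 0$. A De Morgan semi-Heyting algebra is an expansion by a unary operation $'$ satisfying $0'\approx 1$, $1'\approx 0$, $(x\wedge y)'\approx x'\vee y'$, $(x\vee y)''\approx x''\vee y''$, $x''\approx x$. Notation: $x'^*:=(x')^*$, $x^+:=((x')^*)'$. Level 1: $((x\wedge x'^*)')^*\approx x\wedge x'^*$; regular: $x\wedge x^+\le y\vee y^*$. $\mathbf{RDMSH_1}$ is the variety of regular De Morgan semi-Heyting algebras of level 1. $\mathbf{V}(K)$ is the variety generated by $K$. $\mathbf{L^{dm}_{10}}$ is the 3-element chain $0<a<1$ with $\to$ given by $x\to x=1$ for all $x$, $a\to0=1\to0=0$, $1\to a=a$, $0\to a=0\to1=0$, $a\to 1=a$, and unary operation $0'=1$, $1'=0$, $a'=a$. -}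

module Defs where

open import Level using (Level; _⊔_; suc)
open import Data.Nat using (ℕ)
open import Data.Product using (_×_)
open import Relation.Binary.Core using (Rel)
open import Relation.Binary.PropositionalEquality using (_≡_)
open import Algebra.Core using (Op₁; Op₂)
open import Algebra.Lattice.Structures using (IsLattice)

record DMSHSig (c ℓ : Level) : Set (suc (c ⊔ ℓ)) where
  infix  4 _≈_
  infixr 6 _∨_
  infixr 7 _∧_
  infixr 5 _⇒_
  field
    Carrier : Set c
    _≈_     : Rel Carrier ℓ
    _∨_     : Op₂ Carrier
    _∧_     : Op₂ Carrier
    _⇒_     : Op₂ Carrier
    𝟘       : Carrier
    𝟙       : Carrier
    _′      : Op₁ Carrier

  _≤_ : Rel Carrier ℓ
  x ≤ y = (x ∧ y) ≈ x

  _* : Op₁ Carrier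
  x * = x ⇒ 𝟘

  _′* : Op₁ Carrier
  x ′* = (x ′) *

  _⁺ : Op₁ Carrier
  x ⁺ = (x ′*) ′

record IsDMSH {c ℓ} (A : DMSHSig c ℓ) : Set (c ⊔ ℓ) where
  open DMSHSig A
  field
    isLattice : IsLattice _≈_ _∨_ _∧_
    ∨-identityʳ : ∀ x → (x ∨ 𝟘) ≈ x
    ∧-identityʳ : ∀ x → (x ∧ 𝟙) ≈ x
    ⇒-cong : ∀ {x y u v} → x ≈ y → u ≈ v → (x ⇒ u) ≈ (y ⇒ v)
    ′-cong : ∀ {x y} → x ≈ y → (x ′) ≈ (y ′)
    sh1 : ∀ x y → (x ∧ (x ⇒ y)) ≈ (x ∧ y)
    sh2 : ∀ x y z → (x ∧ (y ⇒ z)) ≈ (x ∧ ((x ∧ y) ⇒ (x ∧ z)))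
    sh3 : ∀ x → (x ⇒ x) ≈ 𝟙
    dm1 : (𝟘 ′) ≈ 𝟙
    dm2 : (𝟙 ′) ≈ 𝟘
    dm3 : ∀ x y → ((x ∧ y) ′) ≈ ((x ′) ∨ (y ′))
    dm4 : ∀ x y → (((x ∨ y) ′) ′) ≈ (((x ′) ′) ∨ ((y ′) ′))
    dm5 : ∀ x → ((x ′) ′) ≈ x

Level1 : ∀ {c ℓ} → DMSHSig c ℓ → Set (c ⊔ ℓ)
Level1 A = ∀ x → (((x ∧ (x ′*)) ′) *) ≈ (x ∧ (x ′*))
  where open DMSHSig A

Regular : ∀ {c ℓ} → DMSHSig c ℓ → Set (c ⊔ ℓ)
Regular A = ∀ x y → (x ∧ (x ⁺)) ≤ (y ∨ (y *))
  where open DMSHSig A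

IsRDMSH₁ : ∀ {c ℓ} → DMSHSig c ℓ → Set (c ⊔ ℓ)
IsRDMSH₁ A = IsDMSH A × Level1 A × Regular A

Identity1 : ∀ {c ℓ} → DMSHSig c ℓ → Set (c ⊔ ℓ)
Identity1 A = ∀ x y → (x ∧ (x ′)) ≤ (y ∨ (y ′))
  where open DMSHSig A

Identity2 : ∀ {c ℓ} → DMSHSig c ℓ → Set (c ⊔ ℓ)
Identity2 A = ∀ x y → (x ⇒ y) ≈ (y ⇒ x)
  where open DMSHSig A

data Term : Set where
  var        : ℕ → Term
  _∨ₜ_ _∧ₜ_ _⇒ₜ_ : Term → Term → Term
  0ₜ 1ₜ      : Term
  _′ₜ        : Term → Term

eval : ∀ {c ℓ} (A : DMSHSig c ℓ) → Term → (ℕ → DMSHSig.Carrier A) → DMSHSig.Carrier A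
eval A (var i)  ρ = ρ i
eval A (s ∨ₜ t) ρ = DMSHSig._∨_ A (eval A s ρ) (eval A t ρ)
eval A (s ∧ₜ t) ρ = DMSHSig._∧_ A (eval A s ρ) (eval A t ρ)
eval A (s ⇒ₜ t) ρ = DMSHSig._⇒_ A (eval A s ρ) (eval A t ρ)
eval A 0ₜ       ρ = DMSHSig.𝟘 A
eval A 1ₜ       ρ = DMSHSig.𝟙 A
eval A (s ′ₜ)   ρ = DMSHSig._′ A (eval A s ρ)

_⊨_≈ₜ_ : ∀ {c ℓ} → DMSHSig c ℓ → Term → Term → Set (c ⊔ ℓ)
A ⊨ s ≈ₜ t = ∀ (ρ : ℕ → DMSHSig.Carrier A) → DMSHSig._≈_ A (eval A s ρ) (eval A t ρ)

data L3 : Set where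
  o a i : L3

join meet imp : L3 → L3 → L3
join o y = y
join a o = a
join a a = a
join a i = i
join i y = i

meet o y = o
meet a o = o
meet a a = a
meet a i = a
meet i y = y

imp o o = i
imp o a = o
imp o i = o
imp a o = o
imp a a = i
imp a i = a
imp i o = o
imp i a = a
imp i i = i

neg : L3 → L3
neg o = i
neg a = a
neg i = o

L10 : DMSHSig Level.zero Level.zero
L10 = record
  { Carrier = L3 ; _≈_ = _≡_ ; _∨_ = join ; _∧_ = meet ; _⇒_ = imp
  ; 𝟘 = o ; 𝟙 = i ; _′ = neg }

-- The variety V(K) generated by K = {L^dm_10}, as the equational class
-- of K: A ∈ V(L10) iff A satisfies every identity that holds in L10.

InV-L10 : ∀ {c ℓ} → DMSHSig c ℓ → Set (c ⊔ ℓ)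
InV-L10 A = ∀ (s t : Term) → L10 ⊨ s ≈ₜ t → A ⊨ s ≈ₜ t

{-# OPTIONS --safe #-}

-- In A, identity (1) and level 1 make every x * complemented, so A splits along the complemented
-- regions x *, x ′* and (x *)′ ∧ (x ′*)′, on which x behaves like the constants 0, 1 and a of L10.
-- On its middle region x is self-dual (by regularity), any two elements agree on a common middle
-- region (by identity (1)), and identity (2) gives 0 → a = a → 0. Hence on each cell of the
-- partition cut out by the variables of an identity, every term evaluates as in L10 under the
-- corresponding valuation, so an identity of L10 holds on every cell and therefore in A.
-- Conversely, (1) and (2) are identities of L10.
module Submission where

open import Defs
open import Level using (Level)
open import Data.Nat using (ℕ; zero; suc; _<_; _⊔_; s≤s)
import Data.Nat as ℕ
open import Data.Nat.Properties using (m⊔n≤o⇒m≤o; m⊔n≤o⇒n≤o; m≤m⊔n; m≤n⊔m; anyUpTo?)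
open import Data.Product using (_×_; _,_; ∃)
open import Data.Sum using (_⊎_; inj₁; inj₂; [_,_])
open import Data.Vec using (Vec; []; _∷_)
open import Function using (_∘_)
open import Function.Bundles using (_⇔_; mk⇔)
open import Relation.Nullary using (Dec; yes; no; contradiction)
open import Relation.Binary.PropositionalEquality as ≡ using (_≡_)
open import Algebra.Lattice.Bundles using (Lattice)
open import Algebra.Lattice.Structures using (IsLattice)
import Algebra.Lattice.Properties.Lattice as LatticeProperties
open import Relation.Binary.Lattice using (HeytingAlgebra)
import Relation.Binary.Lattice.Properties.HeytingAlgebra as HeytingAlgebraProperties
import Relation.Binary.Lattice.Properties.DistributiveLattice as DistributiveLatticeProperties
import Relation.Binary.Lattice.Properties.BoundedLattice as BoundedLatticeProperties
import Relation.Binary.Lattice.Properties.JoinSemilattice as JoinSemilatticeProperties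
import Relation.Binary.Lattice.Properties.MeetSemilattice as MeetSemilatticeProperties
import Relation.Binary.Reasoning.Setoid as SetoidReasoning
import Relation.Binary.Reasoning.PartialOrder as PosetReasoning

varBound : Term → ℕ
varBound (var j)  = suc j
varBound (s ∨ₜ t) = varBound s ⊔ varBound t
varBound (s ∧ₜ t) = varBound s ⊔ varBound t
varBound (s ⇒ₜ t) = varBound s ⊔ varBound t
varBound 0ₜ       = 0
varBound 1ₜ       = 0
varBound (s ′ₜ)   = varBound s

valuation : ∀ {n} → Vec L3 n → ℕ → L3
valuation []       _       = o
valuation (d ∷ _)  zero    = d
valuation (_ ∷ ds) (suc j) = valuation ds j

_≟a : ∀ d → Dec (d ≡ a)
o ≟a = no λ ()
a ≟a = yes ≡.refl
i ≟a = no λ ()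

join≡a : ∀ u w → join u w ≡ a → u ≡ a ⊎ w ≡ a
join≡a a _ _  = inj₁ ≡.refl
join≡a o a _  = inj₂ ≡.refl
join≡a o o ()
join≡a o i ()
join≡a i _ ()

meet≡a : ∀ u w → meet u w ≡ a → u ≡ a ⊎ w ≡ a
meet≡a a _ _  = inj₁ ≡.refl
meet≡a i a _  = inj₂ ≡.refl
meet≡a o _ ()
meet≡a i o ()
meet≡a i i ()

imp≡a : ∀ u w → imp u w ≡ a → u ≡ a ⊎ w ≡ a
imp≡a a _ _  = inj₁ ≡.refl
imp≡a _ a _  = inj₂ ≡.refl
imp≡a o o ()
imp≡a o i ()
imp≡a i o ()
imp≡a i i ()

neg≡a : ∀ u → neg u ≡ a → u ≡ a
neg≡a a _ = ≡.refl
neg≡a o ()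
neg≡a i ()

eval-L10-≡a : ∀ {n} (v : ℕ → L3) t → varBound t ℕ.≤ n → eval L10 t v ≡ a → ∃ λ j → j < n × v j ≡ a
eval-L10-≡a v (var j)  j<n eq = j , j<n , eq
eval-L10-≡a v (s ∨ₜ t) b   eq =
  [ eval-L10-≡a v s (m⊔n≤o⇒m≤o _ _ b) , eval-L10-≡a v t (m⊔n≤o⇒n≤o _ _ b) ] (join≡a _ _ eq)
eval-L10-≡a v (s ∧ₜ t) b   eq =
  [ eval-L10-≡a v s (m⊔n≤o⇒m≤o _ _ b) , eval-L10-≡a v t (m⊔n≤o⇒n≤o _ _ b) ] (meet≡a _ _ eq)
eval-L10-≡a v (s ⇒ₜ t) b   eq =
  [ eval-L10-≡a v s (m⊔n≤o⇒m≤o _ _ b) , eval-L10-≡a v t (m⊔n≤o⇒n≤o _ _ b) ] (imp≡a _ _ eq)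
eval-L10-≡a v 0ₜ       _   ()
eval-L10-≡a v 1ₜ       _   ()
eval-L10-≡a v (s ′ₜ)   b   eq = eval-L10-≡a v s b (neg≡a _ eq)

module DeMorganSemiHeyting {c ℓ} (A : DMSHSig c ℓ) (isDMSH : IsDMSH A) where
  open DMSHSig A hiding (_≤_)
  open IsDMSH isDMSH

  lattice : Lattice c ℓ
  lattice = record { isLattice = isLattice }

  open IsLattice isLattice
  open LatticeProperties lattice using (∨-∧-isOrderTheoreticLattice)
  open LatticeProperties lattice public using (∧-idem; ∨-idem)

  _⇨_ : Carrier → Carrier → Carrier
  x ⇨ y = x ⇒ (x ∧ y)

  heytingAlgebra : HeytingAlgebra c ℓ ℓ
  heytingAlgebra = record
    { _⇨_ = _⇨_
    ; isHeytingAlgebra = record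
      { isBoundedLattice = record
        { isLattice = ∨-∧-isOrderTheoreticLattice
        ; maximum = λ x → sym (∧-identityʳ x)
        ; minimum = 𝟘-least
        }
      ; exponential = λ w x y → ⇨-intro , ⇨-elim
      }
    }
    where
    open SetoidReasoning (Lattice.setoid lattice)

    𝟘-least : ∀ x → 𝟘 ≈ 𝟘 ∧ x
    𝟘-least x = sym (begin
      𝟘 ∧ x        ≈⟨ ∧-congˡ (trans (∨-comm 𝟘 x) (∨-identityʳ x)) ⟨
      𝟘 ∧ (𝟘 ∨ x)  ≈⟨ ∧-absorbs-∨ 𝟘 x ⟩
      𝟘            ∎)

    ⇨-intro : ∀ {w x y} → w ∧ x ≈ (w ∧ x) ∧ y → w ≈ w ∧ (x ⇨ y)
    ⇨-intro {w} {x} {y} w∧x≤y = sym (begin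
      w ∧ (x ⇒ x ∧ y)                ≈⟨ sh2 w x (x ∧ y) ⟩
      w ∧ (w ∧ x ⇒ w ∧ (x ∧ y))      ≈⟨ ∧-congˡ (⇒-cong refl (trans (sym (∧-assoc w x y)) (sym w∧x≤y))) ⟩
      w ∧ (w ∧ x ⇒ w ∧ x)            ≈⟨ ∧-congˡ (sh3 (w ∧ x)) ⟩
      w ∧ 𝟙                          ≈⟨ ∧-identityʳ w ⟩
      w                              ∎)

    ⇨-elim : ∀ {w x y} → w ≈ w ∧ (x ⇨ y) → w ∧ x ≈ (w ∧ x) ∧ y
    ⇨-elim {w} {x} {y} w≤x⇨y = begin
      w ∧ x                    ≈⟨ ∧-congʳ w≤x⇨y ⟩
      (w ∧ (x ⇨ y)) ∧ x        ≈⟨ ∧-assoc w (x ⇨ y) x ⟩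
      w ∧ ((x ⇨ y) ∧ x)        ≈⟨ ∧-congˡ (trans (∧-comm (x ⇨ y) x) (sh1 x (x ∧ y))) ⟩
      w ∧ (x ∧ (x ∧ y))        ≈⟨ ∧-congˡ (∧-assoc x x y) ⟨
      w ∧ ((x ∧ x) ∧ y)        ≈⟨ ∧-congˡ (∧-congʳ (∧-idem x)) ⟩
      w ∧ (x ∧ y)              ≈⟨ ∧-assoc w x y ⟨
      (w ∧ x) ∧ y              ∎

  -- this _≤_ is x ≈ x ∧ y, so a proof of DMSHSig._≤_ (x ∧ y ≈ x) converts by sym
  open HeytingAlgebra heytingAlgebra public
    using (_≤_; x∧y≤x; x∧y≤y; ∧-greatest; ∨-least; minimum; ≤-respʳ-≈; ≤-respˡ-≈)
    renaming (refl to ≤-refl; trans to ≤-trans; antisym to ≤-antisym; reflexive to ≤-reflexive)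
  open HeytingAlgebraProperties heytingAlgebra public using (∧-distribˡ-∨; distributiveLattice)
  open DistributiveLatticeProperties distributiveLattice public using (∧-distribʳ-∨)
  open BoundedLatticeProperties (HeytingAlgebra.boundedLattice heytingAlgebra) public
    using (∧-zeroˡ; ∧-zeroʳ; ∨-zeroˡ; ∨-zeroʳ)
  open MeetSemilatticeProperties (HeytingAlgebra.meetSemilattice heytingAlgebra) public
    using (∧-monotonic)
  open JoinSemilatticeProperties (HeytingAlgebra.joinSemilattice heytingAlgebra) public
    using (∨-monotonic)
  open PosetReasoning (HeytingAlgebra.poset heytingAlgebra)

  ∧-identityˡ : ∀ x → 𝟙 ∧ x ≈ x
  ∧-identityˡ x = trans (∧-comm 𝟙 x) (∧-identityʳ x)

  ∨-identityˡ : ∀ x → 𝟘 ∨ x ≈ x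
  ∨-identityˡ x = trans (∨-comm 𝟘 x) (∨-identityʳ x)

  ≤𝟘⇒≈𝟘 : ∀ {x} → x ≤ 𝟘 → x ≈ 𝟘
  ≤𝟘⇒≈𝟘 x≤𝟘 = ≤-antisym x≤𝟘 (minimum _)

  ⇒-identityˡ : ∀ x → 𝟙 ⇒ x ≈ x
  ⇒-identityˡ x = begin-equality
    𝟙 ⇒ x            ≈⟨ ∧-identityˡ (𝟙 ⇒ x) ⟨
    𝟙 ∧ (𝟙 ⇒ x)      ≈⟨ sh1 𝟙 x ⟩
    𝟙 ∧ x            ≈⟨ ∧-identityˡ x ⟩
    x                ∎

  x*∧x≈𝟘 : ∀ x → x * ∧ x ≈ 𝟘
  x*∧x≈𝟘 x = trans (∧-comm (x *) x) (trans (sh1 x 𝟘) (∧-zeroʳ x))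

  ′-∨ : ∀ x y → (x ∨ y) ′ ≈ x ′ ∧ y ′
  ′-∨ x y = begin-equality
    (x ∨ y) ′              ≈⟨ ′-cong (∨-cong (dm5 x) (dm5 y)) ⟨
    (x ′ ′ ∨ y ′ ′) ′      ≈⟨ ′-cong (dm3 (x ′) (y ′)) ⟨
    (x ′ ∧ y ′) ′ ′        ≈⟨ dm5 (x ′ ∧ y ′) ⟩
    x ′ ∧ y ′              ∎

  Complemented : Carrier → Set ℓ
  Complemented e = e ∧ e ′ ≈ 𝟘

  ∨′≈𝟙 : ∀ {e} → Complemented e → e ∨ e ′ ≈ 𝟙
  ∨′≈𝟙 {e} e∧e′≈𝟘 = begin-equality
    e ∨ e ′                ≈⟨ dm5 (e ∨ e ′) ⟨
    (e ∨ e ′) ′ ′          ≈⟨ ′-cong (′-∨ e (e ′)) ⟩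
    (e ′ ∧ e ′ ′) ′        ≈⟨ ′-cong (trans (∧-congˡ (dm5 e)) (trans (∧-comm (e ′) e) e∧e′≈𝟘)) ⟩
    𝟘 ′                    ≈⟨ dm1 ⟩
    𝟙                      ∎

  complemented-𝟙 : Complemented 𝟙
  complemented-𝟙 = trans (∧-identityˡ (𝟙 ′)) dm2

  complemented-′ : ∀ {e} → Complemented e → Complemented (e ′)
  complemented-′ {e} e∧e′≈𝟘 = trans (∧-congˡ (dm5 e)) (trans (∧-comm (e ′) e) e∧e′≈𝟘)

  complemented-∧ : ∀ {e f} → Complemented e → Complemented f → Complemented (e ∧ f)
  complemented-∧ {e} {f} e∧e′≈𝟘 f∧f′≈𝟘 = ≤𝟘⇒≈𝟘 (begin
    (e ∧ f) ∧ (e ∧ f) ′                  ≈⟨ ∧-congˡ (dm3 e f) ⟩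
    (e ∧ f) ∧ (e ′ ∨ f ′)                ≈⟨ ∧-distribˡ-∨ (e ∧ f) (e ′) (f ′) ⟩
    (e ∧ f) ∧ e ′ ∨ (e ∧ f) ∧ f ′        ≤⟨ ∨-monotonic (∧-monotonic (x∧y≤x e f) ≤-refl)
                                                    (∧-monotonic (x∧y≤y e f) ≤-refl) ⟩
    e ∧ e ′ ∨ f ∧ f ′                    ≈⟨ ∨-cong e∧e′≈𝟘 f∧f′≈𝟘 ⟩
    𝟘 ∨ 𝟘                                ≈⟨ ∨-idem 𝟘 ⟩
    𝟘                                    ∎)

  complemented-∨ : ∀ {e f} → Complemented e → Complemented f → Complemented (e ∨ f)
  complemented-∨ {e} {f} e∧e′≈𝟘 f∧f′≈𝟘 = ≤𝟘⇒≈𝟘 (begin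
    (e ∨ f) ∧ (e ∨ f) ′                  ≈⟨ ∧-congˡ (′-∨ e f) ⟩
    (e ∨ f) ∧ (e ′ ∧ f ′)                ≈⟨ ∧-comm (e ∨ f) (e ′ ∧ f ′) ⟩
    (e ′ ∧ f ′) ∧ (e ∨ f)                ≈⟨ ∧-distribˡ-∨ (e ′ ∧ f ′) e f ⟩
    (e ′ ∧ f ′) ∧ e ∨ (e ′ ∧ f ′) ∧ f    ≤⟨ ∨-monotonic (∧-monotonic (x∧y≤x (e ′) (f ′)) ≤-refl)
                                                    (∧-monotonic (x∧y≤y (e ′) (f ′)) ≤-refl) ⟩
    e ′ ∧ e ∨ f ′ ∧ f                    ≈⟨ ∨-cong (trans (∧-comm (e ′) e) e∧e′≈𝟘) (trans (∧-comm (f ′) f) f∧f′≈𝟘) ⟩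
    𝟘 ∨ 𝟘                                ≈⟨ ∨-idem 𝟘 ⟩
    𝟘                                    ∎)

  infix 4 _≈[_]_
  _≈[_]_ : Carrier → Carrier → Carrier → Set ℓ
  x ≈[ e ] y = e ∧ x ≈ e ∧ y

  ≈[]-antitone : ∀ {e f x y} → f ≤ e → x ≈[ e ] y → x ≈[ f ] y
  ≈[]-antitone {e} {f} {x} {y} f≤e x≈[e]y = begin-equality
    f ∧ x          ≈⟨ ∧-congʳ f≤e ⟩
    (f ∧ e) ∧ x    ≈⟨ ∧-assoc f e x ⟩
    f ∧ (e ∧ x)    ≈⟨ ∧-congˡ x≈[e]y ⟩
    f ∧ (e ∧ y)    ≈⟨ ∧-assoc f e y ⟨
    (f ∧ e) ∧ y    ≈⟨ ∧-congʳ f≤e ⟨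
    f ∧ y          ∎

  ≈[]-join : ∀ {e f x y} → x ≈[ e ] y → x ≈[ f ] y → x ≈[ e ∨ f ] y
  ≈[]-join {e} {f} {x} {y} x≈[e]y x≈[f]y = begin-equality
    (e ∨ f) ∧ x        ≈⟨ ∧-distribʳ-∨ x e f ⟩
    e ∧ x ∨ f ∧ x      ≈⟨ ∨-cong x≈[e]y x≈[f]y ⟩
    e ∧ y ∨ f ∧ y      ≈⟨ ∧-distribʳ-∨ y e f ⟨
    (e ∨ f) ∧ y        ∎

  ≈[]-intro : ∀ {e x y} → e ∧ x ≤ y → e ∧ y ≤ x → x ≈[ e ] y
  ≈[]-intro {e} {x} {y} e∧x≤y e∧y≤x =
    ≤-antisym (∧-greatest (x∧y≤x e x) e∧x≤y) (∧-greatest (x∧y≤x e y) e∧y≤x)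

  ≈[𝟙]⇒≈ : ∀ {x y} → x ≈[ 𝟙 ] y → x ≈ y
  ≈[𝟙]⇒≈ {x} {y} x≈[𝟙]y = trans (sym (∧-identityˡ x)) (trans x≈[𝟙]y (∧-identityˡ y))

  ∧-cong[] : ∀ {e x y u v} → x ≈[ e ] y → u ≈[ e ] v → x ∧ u ≈[ e ] y ∧ v
  ∧-cong[] {e} {x} {y} {u} {v} x≈[e]y u≈[e]v = begin-equality
    e ∧ (x ∧ u)    ≈⟨ ∧-assoc e x u ⟨
    (e ∧ x) ∧ u    ≈⟨ ∧-congʳ x≈[e]y ⟩
    (e ∧ y) ∧ u    ≈⟨ ∧-congʳ (∧-comm e y) ⟩
    (y ∧ e) ∧ u    ≈⟨ ∧-assoc y e u ⟩
    y ∧ (e ∧ u)    ≈⟨ ∧-congˡ u≈[e]v ⟩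
    y ∧ (e ∧ v)    ≈⟨ ∧-assoc y e v ⟨
    (y ∧ e) ∧ v    ≈⟨ ∧-congʳ (∧-comm y e) ⟩
    (e ∧ y) ∧ v    ≈⟨ ∧-assoc e y v ⟩
    e ∧ (y ∧ v)    ∎

  ∨-cong[] : ∀ {e x y u v} → x ≈[ e ] y → u ≈[ e ] v → x ∨ u ≈[ e ] y ∨ v
  ∨-cong[] {e} {x} {y} {u} {v} x≈[e]y u≈[e]v = begin-equality
    e ∧ (x ∨ u)        ≈⟨ ∧-distribˡ-∨ e x u ⟩
    e ∧ x ∨ e ∧ u      ≈⟨ ∨-cong x≈[e]y u≈[e]v ⟩
    e ∧ y ∨ e ∧ v      ≈⟨ ∧-distribˡ-∨ e y v ⟨
    e ∧ (y ∨ v)        ∎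

  ⇒-cong[] : ∀ {e x y u v} → x ≈[ e ] y → u ≈[ e ] v → x ⇒ u ≈[ e ] y ⇒ v
  ⇒-cong[] {e} {x} {y} {u} {v} x≈[e]y u≈[e]v = begin-equality
    e ∧ (x ⇒ u)                ≈⟨ sh2 e x u ⟩
    e ∧ (e ∧ x ⇒ e ∧ u)        ≈⟨ ∧-congˡ (⇒-cong x≈[e]y u≈[e]v) ⟩
    e ∧ (e ∧ y ⇒ e ∧ v)        ≈⟨ sh2 e y v ⟨
    e ∧ (y ⇒ v)                ∎

  ′-cong[] : ∀ {e x y} → Complemented e → x ≈[ e ] y → x ′ ≈[ e ] y ′
  ′-cong[] {e} {x} {y} e∧e′≈𝟘 x≈[e]y = begin-equality
    e ∧ x ′              ≈⟨ ′-absorb x ⟨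
    e ∧ (e ∧ x) ′        ≈⟨ ∧-congˡ (′-cong x≈[e]y) ⟩
    e ∧ (e ∧ y) ′        ≈⟨ ′-absorb y ⟩
    e ∧ y ′              ∎
    where
    ′-absorb : ∀ z → e ∧ (e ∧ z) ′ ≈ e ∧ z ′
    ′-absorb z = begin-equality
      e ∧ (e ∧ z) ′          ≈⟨ ∧-congˡ (dm3 e z) ⟩
      e ∧ (e ′ ∨ z ′)        ≈⟨ ∧-distribˡ-∨ e (e ′) (z ′) ⟩
      e ∧ e ′ ∨ e ∧ z ′      ≈⟨ ∨-congʳ e∧e′≈𝟘 ⟩
      𝟘 ∨ e ∧ z ′            ≈⟨ ∨-identityˡ (e ∧ z ′) ⟩
      e ∧ z ′                ∎

module Decomposition {c ℓ} (A : DMSHSig c ℓ) (isDMSH : IsDMSH A) (level1 : Level1 A) (regular : Regular A)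
                     (identity1 : Identity1 A) (identity2 : Identity2 A) where
  open DMSHSig A hiding (_≤_)
  open IsDMSH isDMSH
  open IsLattice isLattice
  open DeMorganSemiHeyting A isDMSH
  open PosetReasoning (HeytingAlgebra.poset heytingAlgebra)

  ⇒-identityʳ : ∀ x → x ⇒ 𝟙 ≈ x
  ⇒-identityʳ x = trans (identity2 x 𝟙) (⇒-identityˡ x)

  *≤′ : ∀ x → x * ≤ x ′
  *≤′ x = begin
    x *                              ≈⟨ ∧-identityʳ (x *) ⟨
    x * ∧ 𝟙                          ≈⟨ ∧-congˡ 𝟙≈x*′∨x′ ⟩
    x * ∧ (x * ′ ∨ x ′)              ≈⟨ ∧-distribˡ-∨ (x *) (x * ′) (x ′) ⟩
    x * ∧ x * ′ ∨ x * ∧ x ′          ≤⟨ ∨-least x*∧x*′≤x′ (x∧y≤y (x *) (x ′)) ⟩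
    x ′                              ∎
    where
    𝟙≈x*′∨x′ : 𝟙 ≈ x * ′ ∨ x ′
    𝟙≈x*′∨x′ = trans (sym dm1) (trans (′-cong (sym (x*∧x≈𝟘 x))) (dm3 (x *) x))

    x*∧x*′≤x′ : x * ∧ x * ′ ≤ x ′
    x*∧x*′≤x′ = begin
      x * ∧ x * ′                  ≤⟨ ∧-greatest (x∧y≤x (x *) (x * ′)) (sym (identity1 (x *) x)) ⟩
      x * ∧ (x ∨ x ′)              ≈⟨ ∧-distribˡ-∨ (x *) x (x ′) ⟩
      x * ∧ x ∨ x * ∧ x ′          ≈⟨ ∨-congʳ (x*∧x≈𝟘 x) ⟩
      𝟘 ∨ x * ∧ x ′                ≈⟨ ∨-identityˡ (x * ∧ x ′) ⟩
      x * ∧ x ′                    ≤⟨ x∧y≤y (x *) (x ′) ⟩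
      x ′                          ∎

  ′*≤ : ∀ x → x ′* ≤ x
  ′*≤ x = ≤-respʳ-≈ (dm5 x) (*≤′ (x ′))

  *′*≈* : ∀ x → x * ′* ≈ x *
  *′*≈* x = begin-equality
    x * ′*                        ≈⟨ ⇒-cong (′-cong x′∧x′′*≈x*) refl ⟨
    (x ′ ∧ x ′ ′*) ′*             ≈⟨ level1 (x ′) ⟩
    x ′ ∧ x ′ ′*                  ≈⟨ x′∧x′′*≈x* ⟩
    x *                           ∎
    where
    x′∧x′′*≈x* : x ′ ∧ x ′ ′* ≈ x *
    x′∧x′′*≈x* = begin-equality
      x ′ ∧ x ′ ′*                ≈⟨ ∧-congˡ (⇒-cong (dm5 x) refl) ⟩
      x ′ ∧ x *                   ≈⟨ ∧-comm (x ′) (x *) ⟩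
      x * ∧ x ′                   ≈⟨ *≤′ x ⟨
      x *                         ∎

  *-complemented : ∀ x → Complemented (x *)
  *-complemented x = trans (∧-congʳ (sym (*′*≈* x))) (x*∧x≈𝟘 (x * ′))

  -- region d x is the complemented element on which x takes the value d of L10
  region : L3 → Carrier → Carrier
  region o x = x *
  region a x = x * ′ ∧ x ′* ′
  region i x = x ′*

  region-complemented : ∀ d x → Complemented (region d x)
  region-complemented o x = *-complemented x
  region-complemented a x =
    complemented-∧ (complemented-′ (*-complemented x)) (complemented-′ (*-complemented (x ′)))
  region-complemented i x = *-complemented (x ′)

  regions-cover : ∀ x → region o x ∨ (region i x ∨ region a x) ≈ 𝟙
  regions-cover x = begin-equality
    x * ∨ (x ′* ∨ x * ′ ∧ x ′* ′)     ≈⟨ ∨-assoc (x *) (x ′*) (x * ′ ∧ x ′* ′) ⟨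
    (x * ∨ x ′*) ∨ x * ′ ∧ x ′* ′     ≈⟨ ∨-congˡ (′-∨ (x *) (x ′*)) ⟨
    (x * ∨ x ′*) ∨ (x * ∨ x ′*) ′     ≈⟨ ∨′≈𝟙 (complemented-∨ (*-complemented x) (*-complemented (x ′))) ⟩
    𝟙                                 ∎

  region-a-′ : ∀ x → region a (x ′) ≈ region a x
  region-a-′ x = trans (∧-congˡ (′-cong (⇒-cong (dm5 x) refl))) (∧-comm (x ′* ′) (x * ′))

  region-a∧≤′ : ∀ x → region a x ∧ x ≤ x ′
  region-a∧≤′ x = begin
    k ∧ x                   ≤⟨ ∧-greatest (x∧y≤x k x) k∧x≤x′∨x′* ⟩
    k ∧ (x ′ ∨ x ′*)        ≈⟨ ∧-distribˡ-∨ k (x ′) (x ′*) ⟩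
    k ∧ x ′ ∨ k ∧ x ′*      ≈⟨ ∨-congˡ k∧x′*≈𝟘 ⟩
    k ∧ x ′ ∨ 𝟘             ≈⟨ ∨-identityʳ (k ∧ x ′) ⟩
    k ∧ x ′                 ≤⟨ x∧y≤y k (x ′) ⟩
    x ′                     ∎
    where
    k : Carrier
    k = region a x

    k∧x≤x′∨x′* : k ∧ x ≤ x ′ ∨ x ′*
    k∧x≤x′∨x′* = begin
      k ∧ x                 ≈⟨ ∧-comm k x ⟩
      x ∧ k                 ≤⟨ ∧-monotonic ≤-refl (x∧y≤y (x * ′) (x ⁺)) ⟩
      x ∧ x ⁺               ≤⟨ sym (regular x (x ′)) ⟩
      x ′ ∨ x ′*            ∎

    k∧x′*≈𝟘 : k ∧ x ′* ≈ 𝟘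
    k∧x′*≈𝟘 = ≤𝟘⇒≈𝟘 (begin
      k ∧ x ′*              ≤⟨ ∧-monotonic (x∧y≤y (x * ′) (x ′* ′)) ≤-refl ⟩
      x ′* ′ ∧ x ′*         ≈⟨ ∧-comm (x ′* ′) (x ′*) ⟩
      x ′* ∧ x ′* ′         ≈⟨ *-complemented (x ′) ⟩
      𝟘                     ∎)

  ′≈[region-a] : ∀ x → x ′ ≈[ region a x ] x
  ′≈[region-a] x = ≈[]-intro k∧x′≤x (region-a∧≤′ x)
    where
    k∧x′≤x : region a x ∧ x ′ ≤ x
    k∧x′≤x = ≤-respˡ-≈ (∧-congʳ (region-a-′ x)) (≤-respʳ-≈ (dm5 x) (region-a∧≤′ (x ′)))

  x*≈[region-a]𝟘 : ∀ x → x * ≈[ region a x ] 𝟘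
  x*≈[region-a]𝟘 x = trans (≤𝟘⇒≈𝟘 k∧x*≤𝟘) (sym (∧-zeroʳ (region a x)))
    where
    k∧x*≤𝟘 : region a x ∧ x * ≤ 𝟘
    k∧x*≤𝟘 = begin
      region a x ∧ x *      ≤⟨ ∧-monotonic (x∧y≤x (x * ′) (x ′* ′)) ≤-refl ⟩
      x * ′ ∧ x *           ≈⟨ ∧-comm (x * ′) (x *) ⟩
      x * ∧ x * ′           ≈⟨ *-complemented x ⟩
      𝟘                     ∎

  ≈[region-a]-unique : ∀ {e x y} → e ≤ region a x → e ≤ region a y → x ≈[ e ] y
  ≈[region-a]-unique e≤kx e≤ky = ≈[]-intro (∧-≤ e≤kx e≤ky) (∧-≤ e≤ky e≤kx)
    where
    ∧-≤ : ∀ {e x y} → e ≤ region a x → e ≤ region a y → e ∧ x ≤ y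
    ∧-≤ {e} {x} {y} e≤kx e≤ky = begin
      e ∧ x                    ≤⟨ ∧-greatest (≤-trans (x∧y≤x e x) e≤ky) (≤-trans e∧x≤x∧x′ (sym (identity1 x y))) ⟩
      k ∧ (y ∨ y ′)            ≈⟨ ∧-distribˡ-∨ k y (y ′) ⟩
      k ∧ y ∨ k ∧ y ′          ≈⟨ ∨-congˡ (′≈[region-a] y) ⟩
      k ∧ y ∨ k ∧ y            ≈⟨ ∨-idem (k ∧ y) ⟩
      k ∧ y                    ≤⟨ x∧y≤y k y ⟩
      y                        ∎
      where
      k : Carrier
      k = region a y

      e∧x≤x∧x′ : e ∧ x ≤ x ∧ x ′
      e∧x≤x∧x′ = ∧-greatest (x∧y≤y e x) (≤-trans (∧-monotonic e≤kx ≤-refl) (region-a∧≤′ x))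

  x≈[x*]𝟘 : ∀ x → x ≈[ x * ] 𝟘
  x≈[x*]𝟘 x = trans (x*∧x≈𝟘 x) (sym (∧-zeroʳ (x *)))

  x≈[x′*]𝟙 : ∀ x → x ≈[ x ′* ] 𝟙
  x≈[x′*]𝟙 x = trans (sym (′*≤ x)) (sym (∧-identityʳ (x ′*)))

  rep : Carrier → L3 → Carrier
  rep r o = 𝟘
  rep r a = r
  rep r i = 𝟙

  region-rep : ∀ {e r} d x → e ≤ region d x → (d ≡ a → e ≤ region a r) → x ≈[ e ] rep r d
  region-rep o x e≤x* _   = ≈[]-antitone e≤x* (x≈[x*]𝟘 x)
  region-rep a x e≤kx e≤kr = ≈[region-a]-unique e≤kx (e≤kr ≡.refl)
  region-rep i x e≤x′* _  = ≈[]-antitone e≤x′* (x≈[x′*]𝟙 x)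

  rep-∨ : ∀ r u w → rep r u ∨ rep r w ≈ rep r (join u w)
  rep-∨ r o w = ∨-identityˡ (rep r w)
  rep-∨ r a o = ∨-identityʳ r
  rep-∨ r a a = ∨-idem r
  rep-∨ r a i = ∨-zeroʳ r
  rep-∨ r i w = ∨-zeroˡ (rep r w)

  rep-∧ : ∀ r u w → rep r u ∧ rep r w ≈ rep r (meet u w)
  rep-∧ r o w = ∧-zeroˡ (rep r w)
  rep-∧ r a o = ∧-zeroʳ r
  rep-∧ r a a = ∧-idem r
  rep-∧ r a i = ∧-identityʳ r
  rep-∧ r i w = ∧-identityˡ (rep r w)

  rep-⇒ : ∀ {e r} u w → (u ≡ a → e ≤ region a r) → (w ≡ a → e ≤ region a r) →
          rep r u ⇒ rep r w ≈[ e ] rep r (imp u w)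
  rep-⇒         o o _    _    = ∧-congˡ (sh3 𝟘)
  rep-⇒ {r = r} o a _    e≤kr = trans (∧-congˡ (identity2 𝟘 r)) (≈[]-antitone (e≤kr ≡.refl) (x*≈[region-a]𝟘 r))
  rep-⇒         o i _    _    = ∧-congˡ (trans (identity2 𝟘 𝟙) (⇒-identityˡ 𝟘))
  rep-⇒ {r = r} a o e≤kr _    = ≈[]-antitone (e≤kr ≡.refl) (x*≈[region-a]𝟘 r)
  rep-⇒ {r = r} a a _    _    = ∧-congˡ (sh3 r)
  rep-⇒ {r = r} a i _    _    = ∧-congˡ (⇒-identityʳ r)
  rep-⇒         i o _    _    = ∧-congˡ (⇒-identityˡ 𝟘)
  rep-⇒ {r = r} i a _    _    = ∧-congˡ (⇒-identityˡ r)
  rep-⇒         i i _    _    = ∧-congˡ (sh3 𝟙)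

  rep-′ : ∀ {e r} u → (u ≡ a → e ≤ region a r) → rep r u ′ ≈[ e ] rep r (neg u)
  rep-′         o _    = ∧-congˡ dm1
  rep-′ {r = r} a e≤kr = ≈[]-antitone (e≤kr ≡.refl) (′≈[region-a] r)
  rep-′         i _    = ∧-congˡ dm2

  module _ {e r : Carrier} (e-complemented : Complemented e) {n : ℕ} (ρ : ℕ → Carrier) (v : ℕ → L3)
           (ρ≈[e]v : ∀ {j} → j < n → ρ j ≈[ e ] rep r (v j))
           (e≤kr : (∃ λ j → j < n × v j ≡ a) → e ≤ region a r) where

    eval-local : ∀ t → varBound t ℕ.≤ n → eval A t ρ ≈[ e ] rep r (eval L10 t v)
    eval-local (var j)  j<n = ρ≈[e]v j<n
    eval-local (s ∨ₜ t) b   = trans (∨-cong[] (eval-local s (m⊔n≤o⇒m≤o _ _ b)) (eval-local t (m⊔n≤o⇒n≤o _ _ b)))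
                                    (∧-congˡ (rep-∨ r (eval L10 s v) (eval L10 t v)))
    eval-local (s ∧ₜ t) b   = trans (∧-cong[] (eval-local s (m⊔n≤o⇒m≤o _ _ b)) (eval-local t (m⊔n≤o⇒n≤o _ _ b)))
                                    (∧-congˡ (rep-∧ r (eval L10 s v) (eval L10 t v)))
    eval-local (s ⇒ₜ t) b   = trans (⇒-cong[] (eval-local s (m⊔n≤o⇒m≤o _ _ b)) (eval-local t (m⊔n≤o⇒n≤o _ _ b)))
                                    (rep-⇒ (eval L10 s v) (eval L10 t v)
                                           (e≤kr ∘ eval-L10-≡a v s (m⊔n≤o⇒m≤o _ _ b))
                                           (e≤kr ∘ eval-L10-≡a v t (m⊔n≤o⇒n≤o _ _ b)))
    eval-local 0ₜ       _   = refl
    eval-local 1ₜ       _   = refl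
    eval-local (s ′ₜ)   b   = trans (′-cong[] e-complemented (eval-local s b))
                                    (rep-′ (eval L10 s v) (e≤kr ∘ eval-L10-≡a v s b))

  cell : ∀ {n} → (ℕ → Carrier) → Vec L3 n → Carrier
  cell ρ []       = 𝟙
  cell ρ (d ∷ ds) = region d (ρ 0) ∧ cell (ρ ∘ suc) ds

  cell-complemented : ∀ {n} ρ (ds : Vec L3 n) → Complemented (cell ρ ds)
  cell-complemented ρ []       = complemented-𝟙
  cell-complemented ρ (d ∷ ds) =
    complemented-∧ (region-complemented d (ρ 0)) (cell-complemented (ρ ∘ suc) ds)

  cell≤region : ∀ {n} ρ (ds : Vec L3 n) {j} → j < n → cell ρ ds ≤ region (valuation ds j) (ρ j)
  cell≤region ρ (d ∷ ds) {zero}  _         = x∧y≤x (region d (ρ 0)) (cell (ρ ∘ suc) ds)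
  cell≤region ρ (d ∷ ds) {suc j} (s≤s j<n) =
    ≤-trans (x∧y≤y (region d (ρ 0)) (cell (ρ ∘ suc) ds)) (cell≤region (ρ ∘ suc) ds j<n)

  -- any variable valued a serves as r; if there is none, r is irrelevant
  middle-witness : ∀ {n} ρ (ds : Vec L3 n) →
                   ∃ λ r → (∃ λ j → j < n × valuation ds j ≡ a) → cell ρ ds ≤ region a r
  middle-witness {n} ρ ds with anyUpTo? (λ j → valuation ds j ≟a) n
  ... | yes (j , j<n , vj≡a) =
          ρ j , λ _ → ≡.subst (λ d → cell ρ ds ≤ region d (ρ j)) vj≡a (cell≤region ρ ds j<n)
  ... | no ∄j = 𝟘 , λ ∃j → contradiction ∃j ∄j

  ≈[]-byRegions : ∀ z {c x y} → (∀ d → x ≈[ c ∧ region d z ] y) → x ≈[ c ] y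
  ≈[]-byRegions z {c} local = ≈[]-antitone c≤ (≈[]-join (local o) (≈[]-join (local i) (local a)))
    where
    c≤ : c ≤ c ∧ region o z ∨ (c ∧ region i z ∨ c ∧ region a z)
    c≤ = ≤-reflexive (begin-equality
      c                                                  ≈⟨ ∧-identityʳ c ⟨
      c ∧ 𝟙                                              ≈⟨ ∧-congˡ (regions-cover z) ⟨
      c ∧ (region o z ∨ (region i z ∨ region a z))       ≈⟨ ∧-distribˡ-∨ c (region o z) _ ⟩
      c ∧ region o z ∨ c ∧ (region i z ∨ region a z)     ≈⟨ ∨-congˡ (∧-distribˡ-∨ c (region i z) _) ⟩
      c ∧ region o z ∨ (c ∧ region i z ∨ c ∧ region a z) ∎)

  ≈[]-byCells : ∀ n ρ {c x y} → (∀ (ds : Vec L3 n) → x ≈[ c ∧ cell ρ ds ] y) → x ≈[ c ] y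
  ≈[]-byCells zero    ρ {c} local = ≈[]-antitone (≤-reflexive (sym (∧-identityʳ c))) (local [])
  ≈[]-byCells (suc n) ρ {c} local = ≈[]-byRegions (ρ 0) λ d → ≈[]-byCells n (ρ ∘ suc) λ ds →
    ≈[]-antitone (≤-reflexive (∧-assoc c (region d (ρ 0)) (cell (ρ ∘ suc) ds))) (local (d ∷ ds))

  L10-identity-on-cell : ∀ {s t} → L10 ⊨ s ≈ₜ t → ∀ {n} → varBound s ℕ.≤ n → varBound t ℕ.≤ n →
                         ∀ ρ (ds : Vec L3 n) → eval A s ρ ≈[ cell ρ ds ] eval A t ρ
  L10-identity-on-cell {s} {t} L10⊨s≈t {n} bs bt ρ ds with middle-witness ρ ds
  ... | r , e≤kr = begin-equality
    e ∧ eval A s ρ              ≈⟨ local s bs ⟩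
    e ∧ rep r (eval L10 s v)    ≡⟨ ≡.cong (λ u → e ∧ rep r u) (L10⊨s≈t v) ⟩
    e ∧ rep r (eval L10 t v)    ≈⟨ local t bt ⟨
    e ∧ eval A t ρ              ∎
    where
    e : Carrier
    e = cell ρ ds

    v : ℕ → L3
    v = valuation ds

    local : ∀ u → varBound u ℕ.≤ n → eval A u ρ ≈[ e ] rep r (eval L10 u v)
    local = eval-local (cell-complemented ρ ds) ρ v
      (λ {j} j<n → region-rep (v j) (ρ j) (cell≤region ρ ds j<n) (λ vj≡a → e≤kr (j , j<n , vj≡a)))
      e≤kr

  satisfies-L10-identities : InV-L10 A
  satisfies-L10-identities s t L10⊨s≈t ρ = ≈[𝟙]⇒≈ (≈[]-byCells (varBound s ⊔ varBound t) ρ λ ds →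
    ≈[]-antitone (x∧y≤y 𝟙 (cell ρ ds)) (L10-identity-on-cell {s} {t} L10⊨s≈t (m≤m⊔n _ _) (m≤n⊔m _ _) ρ ds))

L10-identity1 : ∀ x y → meet (meet x (neg x)) (join y (neg y)) ≡ meet x (neg x)
L10-identity1 o _ = ≡.refl
L10-identity1 a o = ≡.refl
L10-identity1 a a = ≡.refl
L10-identity1 a i = ≡.refl
L10-identity1 i _ = ≡.refl

L10-identity2 : ∀ x y → imp x y ≡ imp y x
L10-identity2 o o = ≡.refl
L10-identity2 o a = ≡.refl
L10-identity2 o i = ≡.refl
L10-identity2 a o = ≡.refl
L10-identity2 a a = ≡.refl
L10-identity2 a i = ≡.refl
L10-identity2 i o = ≡.refl
L10-identity2 i a = ≡.refl
L10-identity2 i i = ≡.refl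

InV-L10⇒identities : ∀ {c ℓ} (A : DMSHSig c ℓ) → InV-L10 A → Identity1 A × Identity2 A
InV-L10⇒identities A L10⊨⇒A⊨ =
  (λ x y → L10⊨⇒A⊨ ((x₀ ∧ₜ (x₀ ′ₜ)) ∧ₜ (x₁ ∨ₜ (x₁ ′ₜ))) (x₀ ∧ₜ (x₀ ′ₜ))
                    (λ v → L10-identity1 (v 0) (v 1)) (x ∷ₑ y)) ,
  (λ x y → L10⊨⇒A⊨ (x₀ ⇒ₜ x₁) (x₁ ⇒ₜ x₀) (λ v → L10-identity2 (v 0) (v 1)) (x ∷ₑ y))
  where
  open DMSHSig A using (Carrier)

  x₀ x₁ : Term
  x₀ = var 0
  x₁ = var 1

  _∷ₑ_ : Carrier → Carrier → ℕ → Carrier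
  (x ∷ₑ _) zero    = x
  (_ ∷ₑ y) (suc _) = y

corollary4p22 : ∀ {c ℓ : Level} (A : DMSHSig c ℓ) → IsRDMSH₁ A →
                  (InV-L10 A ⇔ (Identity1 A × Identity2 A))
corollary4p22 A (isDMSH , level1 , regular) = mk⇔ (InV-L10⇒identities A) λ (identity1 , identity2) →
  Decomposition.satisfies-L10-identities A isDMSH level1 regular identity1 identity2
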